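{- Let $f:\mathbb{N}\to\{0,1\}$. For each $n\in\mathbb{N}$, all the ex-machines $\mathfrak{Q}(x),\ \mathfrak{Q}(f(0)\,x),\ \mathfrak{Q}(f(0)f(1)\,x),\ \dots,\ \mathfrak{Q}(f(0)f(1)\dots f(n)\,x)$ along the evolutionary path $\mathfrak{Q}(x)\to\mathfrak{Q}(f(0)\,x)\to\cdots\to\mathfrak{Q}(f(0)\dots f(n)\,x)$ combined have used only a finite amount of tape, a finite number of states, a finite number of instructions, a finite number of executions of instructions, and only a finite number of quantum random bits measured by the quantum random instructions.
   Context: Ex-machines. An ex-machine has a finite set of states $Q=\{0,1,\dots,|Q|-1\}\subset\mathbb{N}$ (which may grow during execution), a halting state $h$, a finite alphabet $A$ containing $\texttt{0},\texttt{1}$ and the blank $\texttt{\#}$, a tape $T:\mathbb{Z}\to A$ that is finitely bounded (blank outside a finite set), a tape head position $k\in\mathbb{Z}$, and a finite instruction set $\mathcal{I}$ in which no two instructions share both their first coordinate (state) and second coordinate (scanned symbol). The machine in state $q$ scanning $a=T(k)$ executes the unique instruction with first two coordinates $(q,a)$; it halts when it enters $h$. Instruction types: (1) standard instruction $(q,a,r,\alpha,y)$ with $y\in\{ -1,0,1\}$: set $T(k)=\alpha$, move to state $r$, move the head to $k+y$. (2) quantum random instruction $(q,a,r,y)$: measure a quantum random bit $b\in\{0,1\}$, set $T(k)=b$, move to state $r$, move the head to $k+y$. (3) meta instruction $(q,a,r,\alpha,y,J)$ with $J$ a standard or quantum random instruction: execute $(q,a,r,\alpha,y)$ as a standard instruction,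 then if $\mathcal{I}$ contains an instruction with the same first two coordinates as $J$, replace it by $J$, otherwise add $J$ to $\mathcal{I}$. State entries of instructions may be written symbolically as $|Q|$ or $|Q|-1$; when an instruction is executed, all its symbolic entries (including those inside $J$) are instantiated with the current number of states $|Q|$ at the start of that step, and if the target state equals $|Q|$ then the new state $|Q|$ is added to $Q$. An instruction whose first coordinate is the symbol $|Q|-1$ (a simple meta instruction) applies when the machine is in state $|Q|-1$ scanning the given symbol and no instruction with those concrete first two coordinates exists; when executed, its instantiated version is executed and added to $\mathcal{I}$. Quantum random bits are independent unbiased Bernoulli trials. If ex-machine $\mathfrak{X}$ started on some finitely bounded tape halts, the ex-machine with the states and instructions present at the halt is what $\mathfrak{X}$ evolves to; repeating this gives an evolutionary path. In the path $\mathfrak{Q}(f(0)\dots f(k-1)\,x)\to\mathfrak{Q}(f(0)\dots f(k)\,x)$ the step is an execution on the input tape for $\texttt{a}^k$ (symbol $\texttt{a}$ on squares $1..k$, blank elsewhere, head on square $0$, initial state $0$). The machines. Alphabet $A=\{\texttt{\#},\texttt{0},\texttt{1},\texttt{N},\texttt{Y},\texttt{a}\}$. Name states $h=1$, $\mathtt{n}=2$, $\mathtt{y}=3$, $\mathtt{t}=4$, $\mathtt{v}=5$, $\mathtt{w}=6$, $\mathtt{x}=7$. Let $\mathcal{B}$ be the following 14 instructions: $(0,\#,8,\#,1)$, $(\mathtt{y},\#,h,\texttt{Y},0)$, $(\mathtt{n},\#,h,\texttt{N},0)$, quantum random $(\mathtt{x},\#,\mathtt{x},0)$ and $(\mathtt{x},\texttt{a},\mathtt{t},0)$,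 meta $(\mathtt{x},\texttt{0},\mathtt{v},\#,0,(|Q|-1,\#,\mathtt{n},\#,1))$, $(\mathtt{x},\texttt{1},\mathtt{w},\#,0,(|Q|-1,\#,\mathtt{y},\#,1))$, $(\mathtt{t},\texttt{0},\mathtt{w},\texttt{a},0,(|Q|-1,\#,\mathtt{n},\#,1))$, $(\mathtt{t},\texttt{1},\mathtt{w},\texttt{a},0,(|Q|-1,\#,\mathtt{y},\#,1))$, $(\mathtt{v},\#,\mathtt{n},\#,1,(|Q|-1,\texttt{a},|Q|,\texttt{a},1))$, $(\mathtt{w},\#,\mathtt{y},\#,1,(|Q|-1,\texttt{a},|Q|,\texttt{a},1))$, $(\mathtt{w},\texttt{a},|Q|,\texttt{a},1,(|Q|-1,\texttt{a},|Q|,\texttt{a},1))$, and simple meta instructions $(|Q|-1,\texttt{a},\mathtt{x},\texttt{a},0)$, $(|Q|-1,\#,\mathtt{x},\#,0)$. The ex-machine $\mathfrak{Q}(x)$ has states $\{0,\dots,8\}$ and instructions $\mathcal{B}\cup\{(8,\#,\mathtt{x},\#,0)\}$. For $a_0,\dots,a_m\in\{0,1\}$, $\mathfrak{Q}(a_0\dots a_m\,x)$ has states $\{0,1,\dots,m+9\}$ and instructions $\mathcal{B}$ together with, for each $0\le i\le m$, $(i+8,\#,b_{i+8},\#,1)$ and $(i+8,\texttt{a},i+9,\texttt{a},1)$, where $b_{i+8}=\mathtt{y}$ if $a_i=1$ and $b_{i+8}=\mathtt{n}$ if $a_i=0$. -}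

module Defs where

open import Data.Nat using (ℕ; zero; suc; _+_; _∸_; _≤_; _<_; _≡ᵇ_; _<ᵇ_)
open import Data.Integer as ℤ using (ℤ; +_; -[1+_]; ∣_∣)
open import Data.Bool using (Bool; true; false; if_then_else_; _∨_; not)
open import Data.List using (List; []; _∷_; _++_; map; length; upTo; allFin; filter)
open import Data.Nat.ListAction using (sum)
open import Data.Maybe using (Maybe; just; nothing)
open import Data.Product using (_×_; _,_)
open import Data.Fin using (Fin)
open import Relation.Binary.PropositionalEquality using (_≡_)
open import Relation.Nullary using (¬_)
open import Relation.Nullary.Decidable using (⌊_⌋)
open import Data.List.Relation.Binary.Permutation.Propositional using (_↭_)

data Sym : Set where
  ♯ s0 s1 sN sY sa : Sym

_==_ : Sym → Sym → Bool
♯  == ♯  = true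
s0 == s0 = true
s1 == s1 = true
sN == sN = true
sY == sY = true
sa == sa = true
_  == _  = false

bitSym : Bool → Sym
bitSym false = s0
bitSym true  = s1

data Move : Set where
  L S R : Move

moveℤ : Move → ℤ
moveℤ L = -[1+ 0 ]
moveℤ S = + 0
moveℤ R = + 1

-- State entries: concrete, or symbolic |Q| / |Q|-1

data SSt : Set where
  lit : ℕ → SSt
  Qsz : SSt
  Qm1 : SSt

inst : ℕ → SSt → ℕ
inst m (lit n) = n
inst m Qsz     = m
inst m Qm1     = m ∸ 1

eqSSt : SSt → SSt → Bool
eqSSt (lit n) (lit k) = n ≡ᵇ k
eqSSt Qsz Qsz = true
eqSSt Qm1 Qm1 = true
eqSSt _ _ = false

data Basic : Set where
  std : SSt → Sym → SSt → Sym → Move → Basic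
  qr  : SSt → Sym → SSt → Move → Basic

data Instr : Set where
  basic : Basic → Instr
  meta  : SSt → Sym → SSt → Sym → Move → Basic → Instr

keyB : Basic → SSt × Sym
keyB (std q a _ _ _) = q , a
keyB (qr q a _ _)    = q , a

key : Instr → SSt × Sym
key (basic J)          = keyB J
key (meta q a _ _ _ _) = q , a

targetB : Basic → SSt
targetB (std _ _ r _ _) = r
targetB (qr _ _ r _)    = r

instB : ℕ → Basic → Basic
instB m (std q a r α y) = std (lit (inst m q)) a (lit (inst m r)) α y
instB m (qr q a r y)    = qr (lit (inst m q)) a (lit (inst m r)) y

instI : ℕ → Instr → Instr
instI m (basic J) = basic (instB m J)
instI m (meta q a r α y J) = meta (lit (inst m q)) a (lit (inst m r)) α y (instB m J)

sameKey : SSt × Sym → Instr → Bool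
sameKey (q , a) i with key i
... | (q' , a') = eqSSt q q' Data.Bool.∧ (a == a')

replaceOrAdd : Instr → List Instr → List Instr
replaceOrAdd J I = J ∷ filter (λ i → not (sameKey (key J) i) Data.Bool.≟ true) I

findConc : ℕ → Sym → List Instr → Maybe Instr
findConc q a [] = nothing
findConc q a (i ∷ is) with sameKey (lit q , a) i
... | true  = just i
... | false = findConc q a is

findSimple : Sym → List Instr → Maybe Instr
findSimple a [] = nothing
findSimple a (i ∷ is) with sameKey (Qm1 , a) i
... | true  = just i
... | false = findSimple a is

-- instruction selected in state q scanning a with |Q| = m;
-- the Bool records whether it is a simple meta instruction
select : ℕ → ℕ → Sym → List Instr → Maybe (Instr × Bool)
select m q a I with findConc q a I
... | just i  = just (i , false)
... | nothing with q ≡ᵇ (m ∸ 1)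
...   | false = nothing
...   | true with findSimple a I
...     | nothing = nothing
...     | just i  = just (i , true)

Tape : Set
Tape = ℤ → Sym

write : Tape → ℤ → Sym → Tape
write T k α z = if ⌊ z ℤ.≟ k ⌋ then α else T z

record Config : Set where
  constructor conf
  field
    nQ     : ℕ          -- |Q|, states are {0,…,|Q|-1}
    instrs : List Instr
    st     : ℕ
    tape   : Tape
    hd     : ℤ
open Config public

h : ℕ
h = 1

-- execute instruction i (symbolic entries instantiated with m = |Q|);
-- b is the measured quantum random bit (used only by a quantum random instruction)
exec : Bool → Config → Instr → Bool → Config
exec b (conf m I q T k) i simple = go i
  where
  I₁ : List Instr
  I₁ = if simple then instI m i ∷ I else I
  go : Instr → Config
  go (basic (std _ _ r α y)) =
    conf (if inst m r ≡ᵇ m then suc m else m) I₁ (inst m r) (write T k α) (k ℤ.+ moveℤ y)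
  go (basic (qr _ _ r y)) =
    conf (if inst m r ≡ᵇ m then suc m else m) I₁ (inst m r) (write T k (bitSym b)) (k ℤ.+ moveℤ y)
  go (meta _ _ r α y J) =
    conf (if (inst m r ≡ᵇ m) ∨ (inst m (targetB J) ≡ᵇ m) then suc m else m)
         (replaceOrAdd (basic (instB m J)) I₁) (inst m r) (write T k α) (k ℤ.+ moveℤ y)

step : Bool → Config → Maybe Config
step b c with select (nQ c) (st c) (tape c (hd c)) (instrs c)
... | nothing           = nothing
... | just (i , simple) = just (exec b c i simple)

measures : Config → Bool
measures c with select (nQ c) (st c) (tape c (hd c)) (instrs c)
... | just (basic (qr _ _ _ _) , _) = true
... | _ = false

data Exec : Config → Config → Set where
  halt : ∀ {c} → st c ≡ h → Exec c c
  next : ∀ {c c' d} (b : Bool) → ¬ (st c ≡ h) → step b c ≡ just c' → Exec c' d → Exec c d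

nSteps : ∀ {c d} → Exec c d → ℕ
nSteps (halt _) = 0
nSteps (next _ _ _ e) = suc (nSteps e)

nBits : ∀ {c d} → Exec c d → ℕ
nBits (halt _) = 0
nBits (next {c} _ _ _ e) = (if measures c then 1 else 0) + nBits e

AllConf : (Config → Set) → ∀ {c d} → Exec c d → Set
AllConf P {c} (halt _) = P c
AllConf P {c} (next _ _ _ e) = P c × AllConf P e

Bounded : ℕ → Config → Set
Bounded B c = (∣ hd c ∣ ≤ B) × (nQ c ≤ B) × (length (instrs c) ≤ B)
            × (∀ z → B < ∣ z ∣ → tape c z ≡ ♯)

record Mach : Set where
  constructor mach
  field
    states : ℕ
    code   : List Instr

SameMach : Config → Mach → Set
SameMach d M = (nQ d ≡ Mach.states M) × (instrs d ↭ Mach.code M)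

-- named states h=1, n=2, y=3, t=4, v=5, w=6, x=7
𝓑 : List Instr
𝓑 = basic (std (lit 0) ♯ (lit 8) ♯ R)
  ∷ basic (std (lit 3) ♯ (lit 1) sY S)
  ∷ basic (std (lit 2) ♯ (lit 1) sN S)
  ∷ basic (qr (lit 7) ♯ (lit 7) S)
  ∷ basic (qr (lit 7) sa (lit 4) S)
  ∷ meta (lit 7) s0 (lit 5) ♯ S (std Qm1 ♯ (lit 2) ♯ R)
  ∷ meta (lit 7) s1 (lit 6) ♯ S (std Qm1 ♯ (lit 3) ♯ R)
  ∷ meta (lit 4) s0 (lit 6) sa S (std Qm1 ♯ (lit 2) ♯ R)
  ∷ meta (lit 4) s1 (lit 6) sa S (std Qm1 ♯ (lit 3) ♯ R)
  ∷ meta (lit 5) ♯ (lit 2) ♯ R (std Qm1 sa Qsz sa R)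
  ∷ meta (lit 6) ♯ (lit 3) ♯ R (std Qm1 sa Qsz sa R)
  ∷ meta (lit 6) sa Qsz sa R (std Qm1 sa Qsz sa R)
  ∷ basic (std Qm1 sa (lit 7) sa S)
  ∷ basic (std Qm1 ♯ (lit 7) ♯ S)
  ∷ []

prefInstrs : ℕ → List Bool → List Instr
prefInstrs i [] = []
prefInstrs i (b ∷ bs) =
    basic (std (lit (i + 8)) ♯ (lit (if b then 3 else 2)) ♯ R)
  ∷ basic (std (lit (i + 8)) sa (lit (suc (i + 8))) sa R)
  ∷ prefInstrs (suc i) bs

-- 𝔔(a₀…a_m x);  𝔔(x) for the empty list
𝔔 : List Bool → Mach
𝔔 [] = mach 9 (𝓑 ++ basic (std (lit 8) ♯ (lit 7) ♯ S) ∷ [])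
𝔔 (b ∷ bs) = mach (length (b ∷ bs) + 9) (𝓑 ++ prefInstrs 0 (b ∷ bs))

-- input tape for a^k: a on squares 1..k, blank elsewhere
inputTape : ℕ → Tape
inputTape k (+ zero)   = ♯
inputTape k (+ suc n)  = if n <ᵇ k then sa else ♯
inputTape k -[1+ n ]   = ♯

initConf : Mach → ℕ → Config
initConf (mach m I) k = conf m I 0 (inputTape k) (+ 0)

prefix : (ℕ → Bool) → ℕ → List Bool
prefix f k = map f (upTo k)

sumFin : ∀ n → (Fin n → ℕ) → ℕ
sumFin n g = sum (map g (allFin n))

module Submission where

-- The theorem does not depend on the particular machines 𝔔(…): it holds
-- because each of the n+1 executions on the path halts, hence is a finite
-- sequence of steps, and a single step can enlarge every measured quantity
-- only by a bounded amount.  Concretely: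
--   * one step adds at most one state, at most two instructions (a simple
--     meta instruction is added and its J is added or replaces another one),
--     moves the head by at most one square and rewrites only the scanned
--     square (stepGrowth);
--   * hence if a configuration is B-bounded (head, |Q|, |𝓘| and the non-blank
--     part of the tape within B) its successor is (2 + B)-bounded, and every
--     configuration of a halting run is bounded by B + 2·(number of steps)
--     (allBounded);
--   * the initial configuration of the run on aᵏ is bounded by
--     k + |Q| + |𝓘| (initBounded).
-- The theorem follows by summing these per-run bounds, the step counts and
-- the bit counts over the n+1 runs; each summand is below the total.

open import Defs
open import Data.Nat using (ℕ; suc; _≤_)
open import Data.Bool using (Bool)
open import Data.Fin using (Fin; toℕ)
open import Data.Product using (_×_; ∃-syntax)

open import Data.Nat using (zero; _+_; _*_; _<_; z≤n; s≤s; _<ᵇ_)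
open import Data.Nat.Properties
open import Data.Integer as ℤ using (+_; -[1+_]; ∣_∣)
open import Data.Integer.Properties using (∣i+j∣≤∣i∣+∣j∣)
open import Data.Bool using (true; false; T; if_then_else_)
open import Data.List using (_∷_; length)
open import Data.List.Properties using (length-filter)
open import Data.List.Membership.Propositional using (_∈_)
open import Data.List.Membership.Propositional.Properties using (∈-allFin; ∈-map⁺)
open import Data.List.Relation.Unary.Any using (here; there)
open import Data.Nat.ListAction using (sum)
open import Data.Maybe using (just; nothing)
open import Data.Product using (_,_)
open import Relation.Binary.PropositionalEquality
open import Relation.Nullary using (¬_; yes; no)
open import Data.Empty using (⊥-elim)

StepGrowth : Config → Config → Set
StepGrowth c c' =
    (nQ c' ≤ suc (nQ c))
  × (length (instrs c') ≤ 2 + length (instrs c))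
  × (∣ hd c' ∣ ≤ suc ∣ hd c ∣)
  × (∀ z → ¬ z ≡ hd c → tape c' z ≡ tape c z)

newStates≤ : ∀ (added : Bool) m → (if added then suc m else m) ≤ suc m
newStates≤ true  m = ≤-refl
newStates≤ false m = n≤1+n m

move≤ : ∀ k y → ∣ k ℤ.+ moveℤ y ∣ ≤ suc ∣ k ∣
move≤ k y = begin
  ∣ k ℤ.+ moveℤ y ∣         ≤⟨ ∣i+j∣≤∣i∣+∣j∣ k (moveℤ y) ⟩
  (∣ k ∣) + (∣ moveℤ y ∣)   ≤⟨ +-monoʳ-≤ (∣ k ∣) (∣move∣≤1 y) ⟩
  (∣ k ∣) + 1               ≡⟨ +-comm (∣ k ∣) 1 ⟩
  suc (∣ k ∣)               ∎
  where
  open ≤-Reasoning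
  ∣move∣≤1 : ∀ y → ∣ moveℤ y ∣ ≤ 1
  ∣move∣≤1 L = s≤s z≤n
  ∣move∣≤1 S = z≤n
  ∣move∣≤1 R = s≤s z≤n

write-frame : ∀ T k α z → ¬ z ≡ k → write T k α z ≡ T z
write-frame T k α z z≢k with z ℤ.≟ k
... | yes z≡k = ⊥-elim (z≢k z≡k)
... | no  _   = refl

addSimple≤ : ∀ (simple : Bool) i m I →
  length (if simple then instI m i ∷ I else I) ≤ suc (length I)
addSimple≤ true  i m I = ≤-refl
addSimple≤ false i m I = n≤1+n _

replaceOrAdd≤ : ∀ J I → length (replaceOrAdd J I) ≤ suc (length I)
replaceOrAdd≤ J I = s≤s (length-filter _ I)

execGrowth : ∀ b c i simple → StepGrowth c (exec b c i simple)
execGrowth b (conf m I _ T k) i@(basic (std _ _ _ α y)) simple =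
  newStates≤ _ m , m≤n⇒m≤1+n (addSimple≤ simple i m I) , move≤ k y ,
  λ z z≢k → write-frame T k α z z≢k
execGrowth b (conf m I _ T k) i@(basic (qr _ _ _ y)) simple =
  newStates≤ _ m , m≤n⇒m≤1+n (addSimple≤ simple i m I) , move≤ k y ,
  λ z z≢k → write-frame T k (bitSym b) z z≢k
execGrowth b (conf m I _ T k) i@(meta _ _ _ α y J) simple =
  newStates≤ _ m ,
  ≤-trans (replaceOrAdd≤ (basic (instB m J)) (if simple then instI m i ∷ I else I))
          (s≤s (addSimple≤ simple i m I)) ,
  move≤ k y , λ z z≢k → write-frame T k α z z≢k

stepGrowth : ∀ b c {c'} → step b c ≡ just c' → StepGrowth c c'
stepGrowth b c eq with select (nQ c) (st c) (tape c (hd c)) (instrs c)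
stepGrowth b c ()   | nothing
stepGrowth b c refl | just (i , simple) = execGrowth b c i simple

bounded-mono : ∀ {B B' c} → B ≤ B' → Bounded B c → Bounded B' c
bounded-mono B≤B' (head≤ , states≤ , instrs≤ , blank) =
  ≤-trans head≤ B≤B' , ≤-trans states≤ B≤B' , ≤-trans instrs≤ B≤B' ,
  λ z B'<∣z∣ → blank z (≤-<-trans B≤B' B'<∣z∣)

allBounded-mono : ∀ {B B' c d} → B ≤ B' → (e : Exec c d) →
  AllConf (Bounded B) e → AllConf (Bounded B') e
allBounded-mono {c = c} B≤B' (halt _)       bd         = bounded-mono {c = c} B≤B' bd
allBounded-mono {c = c} B≤B' (next _ _ _ e) (bd , bds) =
  bounded-mono {c = c} B≤B' bd , allBounded-mono B≤B' e bds

-- One step turns a B-bounded configuration into a (2 + B)-bounded one.  A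
-- square beyond 2 + B is not the scanned one (the head is within B), so it
-- keeps its blank.
bounded-step : ∀ {B c c'} → StepGrowth c c' → Bounded B c → Bounded (2 + B) c'
bounded-step {B} {c} (states' , instrs' , head' , frame) (head≤ , states≤ , instrs≤ , blank) =
  m≤n⇒m≤1+n (≤-trans head' (s≤s head≤)) ,
  m≤n⇒m≤1+n (≤-trans states' (s≤s states≤)) ,
  ≤-trans instrs' (s≤s (s≤s instrs≤)) ,
  λ z 2+B<∣z∣ → trans (frame z (notHead z (far z 2+B<∣z∣))) (blank z (far z 2+B<∣z∣))
  where
  far : ∀ z → 2 + B < ∣ z ∣ → B < ∣ z ∣
  far z 2+B<∣z∣ = ≤-trans (s≤s (m≤n+m B 2)) 2+B<∣z∣
  notHead : ∀ z → B < ∣ z ∣ → ¬ z ≡ hd c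
  notHead z B<∣z∣ refl = <⇒≱ B<∣z∣ head≤

allBounded : ∀ {B c d} → Bounded B c → (e : Exec c d) →
  AllConf (Bounded (nSteps e * 2 + B)) e
allBounded bd (halt _) = bd
allBounded {B} {c} bd (next {c' = c'} b _ eq e) =
  bounded-mono {c = c} (m≤n+m B _) bd ,
  allBounded-mono (≤-reflexive shift) e
    (allBounded (bounded-step {B} {c} {c'} (stepGrowth b c eq) bd) e)
  where
  shift : nSteps e * 2 + (2 + B) ≡ 2 + (nSteps e * 2 + B)
  shift = trans (+-suc _ (suc B)) (cong suc (+-suc _ B))

inputTape-blank : ∀ k z → k < ∣ z ∣ → inputTape k z ≡ ♯
inputTape-blank k (+ zero)  _   = refl
inputTape-blank k -[1+ n ]  _   = refl
inputTape-blank k (+ suc n) k<n+1 with n <ᵇ k in n<ᵇk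
... | false = refl
... | true  = ⊥-elim (<⇒≱ (<ᵇ⇒< n k (subst T (sym n<ᵇk) _)) (≤-pred k<n+1))

initBounded : ∀ M k → Bounded (k + Mach.states M + length (Mach.code M)) (initConf M k)
initBounded (mach m I) k =
  z≤n ,
  ≤-trans (m≤n+m m k) (m≤m+n (k + m) (length I)) ,
  m≤n+m (length I) (k + m) ,
  λ z bound<∣z∣ → inputTape-blank k z
    (≤-<-trans (≤-trans (m≤m+n k m) (m≤m+n (k + m) (length I))) bound<∣z∣)

∈⇒≤sum : ∀ {x xs} → x ∈ xs → x ≤ sum xs
∈⇒≤sum {xs = y ∷ ys} (here refl) = m≤m+n y (sum ys)
∈⇒≤sum {xs = y ∷ ys} (there x∈ys) = m≤n⇒m≤o+n y (∈⇒≤sum x∈ys)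

sumFin-≥ : ∀ n (g : Fin n → ℕ) k → g k ≤ sumFin n g
sumFin-≥ n g k = ∈⇒≤sum (∈-map⁺ g (∈-allFin k))

mainTheorem4 : (f : ℕ → Bool) (n : ℕ)
    (ends : Fin (suc n) → Config)
    (runs : (k : Fin (suc n)) → Exec (initConf (𝔔 (prefix f (toℕ k))) (toℕ k)) (ends k))
    (evolves : (k : Fin (suc n)) → SameMach (ends k) (𝔔 (prefix f (suc (toℕ k))))) →
    ∃[ B ] ((∀ k → AllConf (Bounded B) (runs k))
    × (sumFin (suc n) (λ k → nSteps (runs k)) ≤ B)
    × (sumFin (suc n) (λ k → nBits (runs k)) ≤ B))
mainTheorem4 f n ends runs _ =
  space + (steps + bits) ,
  (λ k → allBounded-mono (≤-trans (sumFin-≥ (suc n) runBound k) (m≤m+n space _))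
                         (runs k) (allBounded (initBounded (machine k) (toℕ k)) (runs k))) ,
  m≤n⇒m≤o+n space (m≤m+n steps bits) ,
  m≤n⇒m≤o+n space (m≤n+m bits steps)
  where
  machine : Fin (suc n) → Mach
  machine k = 𝔔 (prefix f (toℕ k))
  -- the bound on all configurations of the k-th run given by allBounded
  runBound : Fin (suc n) → ℕ
  runBound k = nSteps (runs k) * 2 + (toℕ k + Mach.states (machine k) + length (Mach.code (machine k)))
  space steps bits : ℕ
  space = sumFin (suc n) runBound
  steps = sumFin (suc n) (λ k → nSteps (runs k))
  bits  = sumFin (suc n) (λ k → nBits (runs k))
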